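{- Let $0\le r\le n$, let $\mathcal{F}\subseteq\mathcal{M}_{r,n}$ be a set of isomorphism classes, and let $\overline{\mathcal{F}}\subseteq\overline{\mathcal{M}}_{r,n}$ be the set of all matroids whose isomorphism class lies in $\mathcal{F}$. If $\mathcal{F}$ is facial in $\Omega_{r,n}$, then $\overline{\mathcal{F}}$ is facial in $\overline{\Omega}_{r,n}$.
   Context: For integers $0\le r\le n$, $\overline{\mathcal{M}}_{r,n}$ is the set of matroids with ground set $[n]=\{1,\dots,n\}$ and rank $r$, and $\mathcal{M}_{r,n}$ the set of their isomorphism classes; $[\mathsf{M}]$ is the class of $\mathsf{M}$. The base polytope $\mathscr{P}(\mathsf{M})\subseteq\mathbb{R}^n$ is the convex hull of the $0/1$ indicator vectors of bases; $\mathbf{1}_X$ is the indicator function of $X$. A Schubert matroid is a matroid whose lattice of cyclic flats is a chain; $\overline{\mathcal{S}}_{r,n}$ is the set of Schubert matroids in $\overline{\mathcal{M}}_{r,n}$ and $\mathcal{S}_{r,n}$ the set of their isomorphism classes. For each $\mathsf{M}$ there are unique integers $a_{\mathsf{S}}(\mathsf{M})$ with $\mathbf{1}_{\mathscr{P}(\mathsf{M})}=\sum_{\mathsf{S}\in\overline{\mathcal{S}}_{r,n}}a_{\mathsf{S}}(\mathsf{M})\mathbf{1}_{\mathscr{P}(\mathsf{S})}$. Let $\overline{p}_{\mathsf{M}}=(a_{\mathsf{S}}(\mathsf{M}))_{\mathsf{S}}\in\mathbb{Z}^{\overline{\mathcal{S}}_{r,n}}$, and let $p_{[\mathsf{M}]}\in\mathbb{Z}^{\mathcal{S}_{r,n}}$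 have coordinate $\sum_{\mathsf{S}\in c}a_{\mathsf{S}}(\mathsf{M})$ at $c\in\mathcal{S}_{r,n}$. Set $\overline{\Omega}_{r,n}=\operatorname{conv}\{\overline{p}_{\mathsf{M}}\}$, $\Omega_{r,n}=\operatorname{conv}\{p_{[\mathsf{M}]}\}$. A family $\overline{\mathcal{F}}\subseteq\overline{\mathcal{M}}_{r,n}$ is facial in $\overline{\Omega}_{r,n}$ if $\{\overline{p}_{\mathsf{M}}:\mathsf{M}\in\overline{\mathcal{F}}\}$ is exactly the vertex set of some face of $\overline{\Omega}_{r,n}$. A family $\mathcal{F}\subseteq\mathcal{M}_{r,n}$ is facial in $\Omega_{r,n}$ if there is a face $G$ of $\Omega_{r,n}$ with $\mathcal{F}=\{[\mathsf{M}]: p_{[\mathsf{M}]}\in G\}$.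
   Formalization: The polytopes $\overline{\Omega}_{r,n}$ and $\Omega_{r,n}$, their faces, vertices and supporting functionals, and the base polytopes in the identity defining $a_{\mathsf{S}}(\mathsf{M})$ are taken over ℚ, with ℚ^n in place of $\mathbb{R}^n$. -}

module Defs where

open import Data.Bool using (Bool; true; false; _∧_; _∨_; not; T; if_then_else_)
open import Data.Nat using (ℕ; zero; suc; _⊔_; _<ᵇ_; _≡ᵇ_)
open import Data.Fin using (Fin; _≟_)
open import Data.Fin.Subset using (Subset; _∩_; _∪_; ∣_∣; ⁅_⁆)
open import Data.Vec using (Vec; []; _∷_; lookup; tabulate; _[_]≔_)
open import Data.List using (List; []; _∷_; map; _++_; concatMap; allFin; filterᵇ; foldr; zipWith; length; deduplicateᵇ)
open import Data.List.Relation.Unary.All using (All)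
open import Data.Integer using (ℤ)
import Data.Integer as ℤ
open import Data.Rational using (ℚ; 0ℚ; 1ℚ; _+_; _*_; _-_; _≤_; _<_; _/_)
open import Data.Product using (Σ; ∃; _×_)
open import Data.Sum using (_⊎_)
open import Relation.Nullary using (¬_; does)
open import Relation.Binary.PropositionalEquality using (_≡_)

anyB : ∀ {a} {A : Set a} → (A → Bool) → List A → Bool
anyB p = foldr (λ x b → p x ∨ b) false

allB : ∀ {a} {A : Set a} → (A → Bool) → List A → Bool
allB p = foldr (λ x b → p x ∧ b) true

_==ᵇ_ : Bool → Bool → Bool
true  ==ᵇ b = b
false ==ᵇ b = not b

finEq : ∀ {n} → Fin n → Fin n → Bool
finEq i j = does (i ≟ j)

Sub : ℕ → Set
Sub n = Subset n

-- a family of subsets of [n] (used to encode a matroid by its set of bases)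
Fam : ℕ → Set
Fam n = Sub n → Bool

allSubs : (n : ℕ) → List (Sub n)
allSubs zero    = [] ∷ []
allSubs (suc n) = map (false ∷_) (allSubs n) ++ map (true ∷_) (allSubs n)

joinFam : ∀ {n} → Fam n → Fam n → Fam (suc n)
joinFam f g (false ∷ v) = f v
joinFam f g (true  ∷ v) = g v

-- all families of subsets of [n] (every Fam n is extensionally one of these)
allFams : (n : ℕ) → List (Fam n)
allFams zero    = (λ _ → false) ∷ (λ _ → true) ∷ []
allFams (suc n) = concatMap (λ f → map (joinFam f) (allFams n)) (allFams n)

subB : ∀ {n} → Sub n → Sub n → Bool
subB {n} A B = allB (λ i → not (lookup A i) ∨ lookup B i) (allFin n)

removeE : ∀ {n} → Sub n → Fin n → Sub n
removeE A e = A [ e ]≔ false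

addE : ∀ {n} → Sub n → Fin n → Sub n
addE A e = A [ e ]≔ true

isMatroid : ∀ {n} → ℕ → Fam n → Bool
isMatroid {n} r M =
  anyB M (allSubs n)
  ∧ allB (λ B → not (M B) ∨ (∣ B ∣ ≡ᵇ r)) (allSubs n)
  ∧ allB (λ B₁ → allB (λ B₂ → not (M B₁ ∧ M B₂) ∨
       allB (λ x → not (lookup B₁ x ∧ not (lookup B₂ x)) ∨
         anyB (λ y → lookup B₂ y ∧ not (lookup B₁ y) ∧ M (addE (removeE B₁ x) y))
              (allFin n)) (allFin n)) (allSubs n)) (allSubs n)

bases : ∀ {n} → Fam n → List (Sub n)
bases {n} M = filterᵇ M (allSubs n)

rank : ∀ {n} → Fam n → Sub n → ℕ
rank M X = foldr _⊔_ 0 (map (λ B → ∣ B ∩ X ∣) (bases M))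

isIndep : ∀ {n} → Fam n → Sub n → Bool
isIndep M X = anyB (λ B → subB X B) (bases M)

isCircuit : ∀ {n} → Fam n → Sub n → Bool
isCircuit {n} M C = not (isIndep M C)
  ∧ allB (λ e → not (lookup C e) ∨ isIndep M (removeE C e)) (allFin n)

isCyclic : ∀ {n} → Fam n → Sub n → Bool
isCyclic {n} M X = allB (λ e → not (lookup X e) ∨
  anyB (λ C → isCircuit M C ∧ lookup C e ∧ subB C X) (allSubs n)) (allFin n)

isFlat : ∀ {n} → Fam n → Sub n → Bool
isFlat {n} M X = allB (λ e → lookup X e ∨ (rank M X <ᵇ rank M (X ∪ ⁅ e ⁆))) (allFin n)

isCyclicFlat : ∀ {n} → Fam n → Sub n → Bool
isCyclicFlat M X = isCyclic M X ∧ isFlat M X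

isSchubert : ∀ {n} → Fam n → Bool
isSchubert {n} M = allB (λ X → allB (λ Y →
    not (isCyclicFlat M X ∧ isCyclicFlat M Y) ∨ subB X Y ∨ subB Y X)
  (allSubs n)) (allSubs n)

matroids : ℕ → (n : ℕ) → List (Fam n)
matroids r n = filterᵇ (isMatroid r) (allFams n)

schuberts : ℕ → (n : ℕ) → List (Fam n)
schuberts r n = filterᵇ (λ M → isMatroid r M ∧ isSchubert M) (allFams n)

allMaps : (k m : ℕ) → List (Vec (Fin m) k)
allMaps zero    m = [] ∷ []
allMaps (suc k) m = concatMap (λ i → map (i ∷_) (allMaps k m)) (allFin m)

injB : ∀ {n} → Vec (Fin n) n → Bool
injB {n} σ = allB (λ i → allB (λ j →
  not (finEq (lookup σ i) (lookup σ j)) ∨ finEq i j) (allFin n)) (allFin n)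

image : ∀ {n} → Vec (Fin n) n → Sub n → Sub n
image {n} σ B = tabulate (λ j → anyB (λ i → lookup B i ∧ finEq (lookup σ i) j) (allFin n))

iso? : ∀ {n} → Fam n → Fam n → Bool
iso? {n} M M' = anyB (λ σ → injB σ ∧
  allB (λ B → M B ==ᵇ M' (image σ B)) (allSubs n)) (allMaps n n)

-- one representative Schubert matroid per isomorphism class: S_{r,n}
schubertClasses : ℕ → (n : ℕ) → List (Fam n)
schubertClasses r n = deduplicateᵇ iso? (schuberts r n)

sumℚ : List ℚ → ℚ
sumℚ = foldr _+_ 0ℚ

sumℤ : List ℤ → ℤ
sumℤ = foldr ℤ._+_ (ℤ.+ 0)

-- points are functions I → ℚ, compared on a coordinate list cs
_≈[_]_ : ∀ {I : Set} → (I → ℚ) → List I → (I → ℚ) → Set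
x ≈[ cs ] y = All (λ i → x i ≡ y i) cs

dot : ∀ {I : Set} → List I → (I → ℚ) → (I → ℚ) → ℚ
dot cs w x = sumℚ (map (λ i → w i * x i) cs)

InConv : ∀ {I : Set} → List I → List (I → ℚ) → (I → ℚ) → Set
InConv cs ps x = Σ (List ℚ) λ ws →
  length ws ≡ length ps × All (0ℚ ≤_) ws × sumℚ ws ≡ 1ℚ
  × (λ i → sumℚ (zipWith (λ w p → w * p i) ws ps)) ≈[ cs ] x

Valid : ∀ {I : Set} → List I → List (I → ℚ) → (I → ℚ) → ℚ → Set
Valid cs ps w c = ∀ x → InConv cs ps x → dot cs w x ≤ c

InFace : ∀ {I : Set} → List I → List (I → ℚ) → (I → ℚ) → ℚ → (I → ℚ) → Set
InFace cs ps w c x = InConv cs ps x × dot cs w x ≡ c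

IsVertexOfFace : ∀ {I : Set} → List I → List (I → ℚ) → (I → ℚ) → ℚ → (I → ℚ) → Set
IsVertexOfFace cs ps w c v = InFace cs ps w c v ×
  (∀ y z t → InFace cs ps w c y → InFace cs ps w c z → 0ℚ < t → t < 1ℚ →
     v ≈[ cs ] (λ i → t * y i + (1ℚ - t) * z i) → y ≈[ cs ] z)

indVec : ∀ {n} → Sub n → Fin n → ℚ
indVec B i = if lookup B i then 1ℚ else 0ℚ

InBasePolytope : ∀ {n} → Fam n → (Fin n → ℚ) → Set
InBasePolytope {n} M x = InConv (allFin n) (map indVec (bases M)) x

IsIndicatorValue : Set → ℤ → Set
IsIndicatorValue P v = (v ≡ ℤ.+ 1 × P) ⊎ (v ≡ ℤ.+ 0 × ¬ P)

-- a M S = a_S(M): 1_{P(M)} = Σ_{S ∈ \overline{S}_{r,n}} a_S(M) 1_{P(S)}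
IsSchubertExpansion : ℕ → (n : ℕ) → (Fam n → Fam n → ℤ) → Set
IsSchubertExpansion r n a = All (λ M → ∀ (x : Fin n → ℚ) (v : Fam n → ℤ) →
    IsIndicatorValue (InBasePolytope M x) (v M) →
    All (λ S → IsIndicatorValue (InBasePolytope S x) (v S)) (schuberts r n) →
    v M ≡ sumℤ (map (λ S → a M S ℤ.* v S) (schuberts r n)))
  (matroids r n)

toℚ : ℤ → ℚ
toℚ z = z / 1

-- \overline{p}_M ∈ ℤ^{\overline{S}_{r,n}} (coordinates: schuberts r n)
pbar : ∀ {n} → (Fam n → Fam n → ℤ) → Fam n → Fam n → ℚ
pbar a M S = toℚ (a M S)

-- p_[M] ∈ ℤ^{S_{r,n}} (coordinates: schubertClasses r n, a class given by its representative c)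
pcls : ℕ → (n : ℕ) → (Fam n → Fam n → ℤ) → Fam n → Fam n → ℚ
pcls r n a M c = toℚ (sumℤ (map (a M) (filterᵇ (λ S → iso? S c) (schuberts r n))))

FacialBar : ℕ → (n : ℕ) → (Fam n → Fam n → ℤ) → (Fam n → Set) → Set
FacialBar r n a F =
  let cs = schuberts r n
      ps = map (pbar a) (matroids r n)
  in Σ (Fam n → ℚ) λ w → Σ ℚ λ c → Valid cs ps w c ×
     (∀ x → (Data.List.Relation.Unary.Any.Any (λ M → F M × x ≈[ cs ] pbar a M) (matroids r n))
            ⇔ IsVertexOfFace cs ps w c x)
  where
  import Data.List.Relation.Unary.Any
  _⇔_ : Set → Set → Set
  A ⇔ B = (A → B) × (B → A)

-- F (a set of isomorphism classes, given as an isomorphism-invariant predicate) is facial in Ω_{r,n}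
FacialCls : ℕ → (n : ℕ) → (Fam n → Fam n → ℤ) → (Fam n → Set) → Set
FacialCls r n a F =
  let cs = schubertClasses r n
      ps = map (pcls r n a) (matroids r n)
  in Σ (Fam n → ℚ) λ w → Σ ℚ λ c → Valid cs ps w c ×
     All (λ M → (F M → InFace cs ps w c (pcls r n a M)) × (InFace cs ps w c (pcls r n a M) → F M))
         (matroids r n)

IsoInvariant : ∀ {n} → (Fam n → Set) → Set
IsoInvariant {n} F = ∀ (M M' : Fam n) → T (iso? M M') → F M → F M'

{-# OPTIONS --safe #-}
module Submission where

-- The inequality w · p ≤ c cutting out the face of Ω_{r,n} pulls back to w̄ · p̄ ≤ c on
-- Ω̄_{r,n} with w̄_S = w_[S]: summing Schubert coordinates over isomorphism classes is
-- linear, so w̄ · p̄_M = w · p_[M]. Hence p̄_M lies on the new face exactly when [M] ∈ F,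
-- and every vertex of this face, like every vertex of a face of a polytope, is one of the
-- points p̄_M. It remains that each p̄_M is a vertex of Ω̄_{r,n}. Evaluating the Schubert
-- expansion at the indicator vector of a set B gives Σ_S a_S(M) [B basis of S] = [B basis
-- of M], so the linear functional L_B(p̄) = Σ_S [B basis of S] p̄_S takes 0/1 values at the
-- points p̄_M and stays in [0, 1] on Ω̄_{r,n}. If p̄_M = t y + (1 - t) z with 0 < t < 1,
-- this forces L_B y = L_B z = [B basis of M] for every B, and a convex combination of the
-- p̄_M′ with these values puts weight only on M′ = M; so y = z = p̄_M.

open import Defs
open import Algebra.Bundles using (CommutativeMonoid)
open import Data.Bool using (Bool; true; false; T; if_then_else_)
open import Data.Integer as ℤ using (ℤ)
import Data.Integer.Properties as ℤ
open import Data.List using (List; []; _∷_; map; zip; zipWith; length; allFin; filterᵇ)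
open import Data.List.Membership.Propositional using (_∈_; find; lose)
open import Data.List.Membership.Propositional.Properties
  using (∈-map⁺; ∈-++⁺ˡ; ∈-++⁺ʳ; ∈-filter⁺; ∈-filter⁻; ∈-allFin)
open import Data.List.Properties using (length-map; map-id; zipWith-map; map-zipWith)
open import Data.List.Relation.Unary.All as All using (All; []; _∷_)
import Data.List.Relation.Unary.All.Properties as All
open import Data.List.Relation.Unary.Any using (Any; here; there)
import Data.List.Relation.Unary.Any.Properties as Any
open import Data.Nat using (ℕ; zero; suc)
import Data.Nat as ℕ using (_≤_)
open import Data.Nat.Properties using (suc-injective)
open import Data.Product using (∃; _×_; _,_; proj₁; proj₂)
open import Data.Rational
  using (ℚ; 0ℚ; 1ℚ; _+_; _*_; _-_; -_; _≤_; _<_; 1/_; NonZero; positive; nonNegative; toℚᵘ)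
open import Data.Rational.Properties
import Data.Rational.Solver as ℚ-Solver
import Data.Rational.Unnormalised as ℚᵘ
import Data.Rational.Unnormalised.Properties as ℚᵘ
open import Data.Sum using (_⊎_; inj₁; inj₂)
open import Data.Unit using (tt)
open import Data.Vec using (lookup) renaming ([] to []ᵛ; _∷_ to _∷ᵛ_)
open import Data.Vec.Properties using (tabulate∘lookup; tabulate-cong)
open import Function using (id; _∘_)
open import Relation.Binary.Definitions using (tri<; tri≈; tri>)
open import Relation.Binary.PropositionalEquality
open import Relation.Nullary.Decidable using (T?)
open import Relation.Nullary.Negation using (contradiction)

open import Algebra.Properties.Group +-0-group using (x∙y⁻¹≈ε⇒x≈y; ∙-cancelʳ)
open import Algebra.Properties.CommutativeSemigroup
  (CommutativeMonoid.commutativeSemigroup +-0-commutativeMonoid) using (interchange)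
open ℚ-Solver.+-*-Solver using (solve; _:+_; _:*_; _:-_; con; _:=_)

-- Rational arithmetic and finite sums

indicator : Bool → ℚ
indicator b = if b then 1ℚ else 0ℚ

0≤1 : 0ℚ ≤ 1ℚ
0≤1 = nonNegative⁻¹ 1ℚ

0≤indicator : ∀ b → 0ℚ ≤ indicator b
0≤indicator true  = 0≤1
0≤indicator false = ≤-refl

indicator≤1 : ∀ b → indicator b ≤ 1ℚ
indicator≤1 true  = ≤-refl
indicator≤1 false = 0≤1

indicator-injective : ∀ {b b′} → indicator b ≡ indicator b′ → b ≡ b′
indicator-injective {true}  {true}  _   = refl
indicator-injective {false} {false} _   = refl
indicator-injective {true}  {false} 1≡0 = contradiction 1≡0 1≢0
indicator-injective {false} {true}  0≡1 = contradiction (sym 0≡1) 1≢0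

0≤p∧0≤q⇒0≤p*q : ∀ {p q} → 0ℚ ≤ p → 0ℚ ≤ q → 0ℚ ≤ p * q
0≤p∧0≤q⇒0≤p*q {p} {q} 0≤p 0≤q =
  nonNegative⁻¹ (p * q) {{nonNeg*nonNeg⇒nonNeg p {{nonNegative 0≤p}} q {{nonNegative 0≤q}}}}

p≤q⇒0≤q-p : ∀ {p q} → p ≤ q → 0ℚ ≤ q - p
p≤q⇒0≤q-p {p} {q} p≤q = subst (_≤ q - p) (+-inverseʳ p) (+-monoˡ-≤ (- p) p≤q)

p<q⇒0<q-p : ∀ {p q} → p < q → 0ℚ < q - p
p<q⇒0<q-p {p} {q} p<q = subst (_< q - p) (+-inverseʳ p) (+-monoˡ-< (- p) p<q)

0≤p⇒p≡0⊎0<p : ∀ {p} → 0ℚ ≤ p → p ≡ 0ℚ ⊎ 0ℚ < p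
0≤p⇒p≡0⊎0<p {p} 0≤p with <-cmp 0ℚ p
... | tri< 0<p _ _ = inj₂ 0<p
... | tri≈ _ 0≡p _ = inj₁ (sym 0≡p)
... | tri> _ _ p<0 = contradiction (<-≤-trans p<0 0≤p) (<-irrefl refl)

0≤p∧0≤q∧p+q≡0⇒p≡0 : ∀ {p q} → 0ℚ ≤ p → 0ℚ ≤ q → p + q ≡ 0ℚ → p ≡ 0ℚ
0≤p∧0≤q∧p+q≡0⇒p≡0 {p} {q} 0≤p 0≤q p+q≡0 =
  ≤-antisym (subst₂ _≤_ (+-identityʳ p) p+q≡0 (+-monoʳ-≤ p 0≤q)) 0≤p

0<p∧p*q≡0⇒q≡0 : ∀ {p q} → 0ℚ < p → p * q ≡ 0ℚ → q ≡ 0ℚ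
0<p∧p*q≡0⇒q≡0 {p} {q} 0<p pq≡0 = begin
  q                ≡⟨ *-identityˡ q ⟨
  1ℚ * q           ≡⟨ cong (_* q) (*-inverseˡ p) ⟨
  (1/ p * p) * q   ≡⟨ *-assoc (1/ p) p q ⟩
  1/ p * (p * q)   ≡⟨ cong (1/ p *_) pq≡0 ⟩
  1/ p * 0ℚ        ≡⟨ *-zeroʳ (1/ p) ⟩
  0ℚ               ∎
  where
  open ≡-Reasoning
  instance
    p≢0 : NonZero p
    p≢0 = pos⇒nonZero p {{positive 0<p}}

module _ {A : Set} where

  sum-cong : ∀ {f g : A → ℚ} xs → All (λ x → f x ≡ g x) xs → sumℚ (map f xs) ≡ sumℚ (map g xs)
  sum-cong []       []           = refl
  sum-cong (x ∷ xs) (fx≡gx ∷ eq) = cong₂ _+_ fx≡gx (sum-cong xs eq)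

  sum-cong-≗ : ∀ {f g : A → ℚ} xs → (∀ x → f x ≡ g x) → sumℚ (map f xs) ≡ sumℚ (map g xs)
  sum-cong-≗ xs f≗g = sum-cong xs (All.universal f≗g xs)

  sum-0 : ∀ (xs : List A) → sumℚ (map (λ _ → 0ℚ) xs) ≡ 0ℚ
  sum-0 []       = refl
  sum-0 (x ∷ xs) = trans (+-identityˡ _) (sum-0 xs)

  sum-+ : ∀ (f g : A → ℚ) xs →
          sumℚ (map (λ x → f x + g x) xs) ≡ sumℚ (map f xs) + sumℚ (map g xs)
  sum-+ f g []       = sym (+-identityʳ 0ℚ)
  sum-+ f g (x ∷ xs) = trans (cong (f x + g x +_) (sum-+ f g xs)) (interchange (f x) (g x) _ _)

  sum-*ˡ : ∀ k (f : A → ℚ) xs → sumℚ (map (λ x → k * f x) xs) ≡ k * sumℚ (map f xs)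
  sum-*ˡ k f []       = sym (*-zeroʳ k)
  sum-*ˡ k f (x ∷ xs) = trans (cong (k * f x +_) (sum-*ˡ k f xs)) (sym (*-distribˡ-+ k (f x) _))

  sum-*ʳ : ∀ k (f : A → ℚ) xs → sumℚ (map (λ x → f x * k) xs) ≡ sumℚ (map f xs) * k
  sum-*ʳ k f []       = sym (*-zeroˡ k)
  sum-*ʳ k f (x ∷ xs) = trans (cong (f x * k +_) (sum-*ʳ k f xs)) (sym (*-distribʳ-+ k (f x) _))

  sum-filter : ∀ (β : A → Bool) k (p : A → ℚ) xs →
               sumℚ (map (λ x → (if β x then k else 0ℚ) * p x) xs) ≡ k * sumℚ (map p (filterᵇ β xs))
  sum-filter β k p []       = sym (*-zeroʳ k)
  sum-filter β k p (x ∷ xs) with β x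
  ... | true  = trans (cong (k * p x +_) (sum-filter β k p xs)) (sym (*-distribˡ-+ k _ _))
  ... | false = trans (cong₂ _+_ (*-zeroˡ (p x)) (sum-filter β k p xs)) (+-identityˡ _)

sum-comm : ∀ {A B : Set} (g : A → B → ℚ) xs ys →
           sumℚ (map (λ x → sumℚ (map (g x) ys)) xs) ≡ sumℚ (map (λ y → sumℚ (map (λ x → g x y) xs)) ys)
sum-comm g []       ys = sym (sum-0 ys)
sum-comm g (x ∷ xs) ys = begin
  sumℚ (map (g x) ys) + sumℚ (map (λ x → sumℚ (map (g x) ys)) xs)
    ≡⟨ cong (sumℚ (map (g x) ys) +_) (sum-comm g xs ys) ⟩
  sumℚ (map (g x) ys) + sumℚ (map (λ y → sumℚ (map (λ x → g x y) xs)) ys)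
    ≡⟨ sum-+ (g x) (λ y → sumℚ (map (λ x → g x y) xs)) ys ⟨
  sumℚ (map (λ y → sumℚ (map (λ x → g x y) (x ∷ xs))) ys) ∎
  where open ≡-Reasoning

sum-regroup : ∀ {A C : Set} (R : A → C → Bool) (w : C → ℚ) (p : A → ℚ) xs cls →
              sumℚ (map (λ x → sumℚ (map (λ c → if R x c then w c else 0ℚ) cls) * p x) xs)
              ≡ sumℚ (map (λ c → w c * sumℚ (map p (filterᵇ (λ x → R x c) xs))) cls)
sum-regroup R w p xs cls = begin
  sumℚ (map (λ x → sumℚ (map (λ c → if R x c then w c else 0ℚ) cls) * p x) xs)
    ≡⟨ sum-cong-≗ xs (λ x → sum-*ʳ (p x) (λ c → if R x c then w c else 0ℚ) cls) ⟨
  sumℚ (map (λ x → sumℚ (map (λ c → (if R x c then w c else 0ℚ) * p x) cls)) xs)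
    ≡⟨ sum-comm (λ x c → (if R x c then w c else 0ℚ) * p x) xs cls ⟩
  sumℚ (map (λ c → sumℚ (map (λ x → (if R x c then w c else 0ℚ) * p x) xs)) cls)
    ≡⟨ sum-cong-≗ cls (λ c → sum-filter (λ x → R x c) (w c) p xs) ⟩
  sumℚ (map (λ c → w c * sumℚ (map p (filterᵇ (λ x → R x c) xs))) cls) ∎
  where open ≡-Reasoning

sum-nonNeg : ∀ {xs} → All (0ℚ ≤_) xs → 0ℚ ≤ sumℚ xs
sum-nonNeg []           = ≤-refl
sum-nonNeg (0≤x ∷ 0≤xs) = +-mono-≤ 0≤x (sum-nonNeg 0≤xs)

sum-nonNeg-≡0 : ∀ {xs} → All (0ℚ ≤_) xs → sumℚ xs ≡ 0ℚ → All (_≡ 0ℚ) xs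
sum-nonNeg-≡0 []                        _     = []
sum-nonNeg-≡0 {x ∷ xs} (0≤x ∷ 0≤xs) x+Σ≡0 = x≡0 ∷ sum-nonNeg-≡0 0≤xs Σ≡0
  where
  x≡0 : x ≡ 0ℚ
  x≡0 = 0≤p∧0≤q∧p+q≡0⇒p≡0 0≤x (sum-nonNeg 0≤xs) x+Σ≡0
  Σ≡0 : sumℚ xs ≡ 0ℚ
  Σ≡0 = 0≤p∧0≤q∧p+q≡0⇒p≡0 (sum-nonNeg 0≤xs) 0≤x (trans (+-comm (sumℚ xs) x) x+Σ≡0)

-- Finite distributions and their means

module _ {A : Set} where

  mean : (A → ℚ) → List (ℚ × A) → ℚ
  mean f zs = sumℚ (map (λ z → proj₁ z * f (proj₂ z)) zs)

  record IsDistribution (zs : List (ℚ × A)) : Set where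
    field
      nonNeg : All (λ z → 0ℚ ≤ proj₁ z) zs
      total  : sumℚ (map proj₁ zs) ≡ 1ℚ

  open IsDistribution

  OnSupport : (A → Set) → List (ℚ × A) → Set
  OnSupport P = All (λ z → 0ℚ < proj₁ z → P (proj₂ z))

  mean-+ : ∀ (f g : A → ℚ) zs → mean (λ m → f m + g m) zs ≡ mean f zs + mean g zs
  mean-+ f g zs = trans (sum-cong-≗ zs (λ z → *-distribˡ-+ (proj₁ z) _ _)) (sum-+ _ _ zs)

  mean-const : ∀ q {zs} → IsDistribution zs → mean (λ _ → q) zs ≡ q
  mean-const q {zs} d = trans (sum-*ʳ q proj₁ zs) (trans (cong (_* q) (total d)) (*-identityˡ q))

  mean-mono : ∀ {f g : A → ℚ} {zs} → All (λ z → 0ℚ ≤ proj₁ z) zs →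
              All (λ z → f (proj₂ z) ≤ g (proj₂ z)) zs → mean f zs ≤ mean g zs
  mean-mono                    []            []            = ≤-refl
  mean-mono {zs = (μ , _) ∷ _} (0≤μ ∷ 0≤μs) (f≤g ∷ fs≤gs) =
    +-mono-≤ (*-monoˡ-≤-nonNeg μ {{nonNegative 0≤μ}} f≤g) (mean-mono 0≤μs fs≤gs)

  mean-≤ : ∀ {f : A → ℚ} {c zs} → IsDistribution zs → All (λ z → f (proj₂ z) ≤ c) zs → mean f zs ≤ c
  mean-≤ {c = c} d f≤c = ≤-trans (mean-mono (nonNeg d) f≤c) (≤-reflexive (mean-const c d))

  mean-≥ : ∀ {f : A → ℚ} {c zs} → IsDistribution zs → All (λ z → c ≤ f (proj₂ z)) zs → c ≤ mean f zs
  mean-≥ {c = c} d c≤f = ≤-trans (≤-reflexive (sym (mean-const c d))) (mean-mono (nonNeg d) c≤f)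

  mean≡0⇒OnSupport≡0 : ∀ {f : A → ℚ} {zs} → All (λ z → 0ℚ ≤ proj₁ z) zs →
                       All (λ z → 0ℚ ≤ f (proj₂ z)) zs → mean f zs ≡ 0ℚ →
                       OnSupport (λ m → f m ≡ 0ℚ) zs
  mean≡0⇒OnSupport≡0 {f} {zs} 0≤μ 0≤f mean≡0 =
    All.map (λ μf≡0 0<μ → 0<p∧p*q≡0⇒q≡0 0<μ μf≡0) (All.map⁻ (sum-nonNeg-≡0 0≤terms mean≡0))
    where
    0≤terms : All (0ℚ ≤_) (map (λ z → proj₁ z * f (proj₂ z)) zs)
    0≤terms = All.map⁺ (All.zipWith (λ (0≤μ , 0≤f) → 0≤p∧0≤q⇒0≤p*q 0≤μ 0≤f) (0≤μ , 0≤f))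

  mean≡max⇒OnSupport≡max : ∀ {f : A → ℚ} {c zs} → IsDistribution zs →
                           All (λ z → f (proj₂ z) ≤ c) zs → mean f zs ≡ c →
                           OnSupport (λ m → f m ≡ c) zs
  mean≡max⇒OnSupport≡max {f} {c} {zs} d f≤c mean≡c =
    All.map (λ gap≡0 0<μ → sym (x∙y⁻¹≈ε⇒x≈y c (f _) (gap≡0 0<μ)))
      (mean≡0⇒OnSupport≡0 (nonNeg d) (All.map p≤q⇒0≤q-p f≤c) meanGap≡0)
    where
    open ≡-Reasoning
    gap : A → ℚ
    gap m = c - f m
    meanGap≡0 : mean gap zs ≡ 0ℚ
    meanGap≡0 = ∙-cancelʳ (mean f zs) (mean gap zs) 0ℚ (begin
      mean gap zs + mean f zs      ≡⟨ mean-+ gap f zs ⟨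
      mean (λ m → gap m + f m) zs  ≡⟨ sum-cong-≗ zs (λ z → cong (proj₁ z *_) (gap+f≡c (f (proj₂ z)))) ⟩
      mean (λ _ → c) zs            ≡⟨ mean-const c d ⟩
      c                            ≡⟨ trans (sym mean≡c) (sym (+-identityˡ _)) ⟩
      0ℚ + mean f zs               ∎)
      where
      gap+f≡c : ∀ x → (c - x) + x ≡ c
      gap+f≡c = solve 2 (λ c x → (c :- x) :+ x := c) refl c

  OnSupport≡⇒mean≡ : ∀ {f : A → ℚ} {q zs} → IsDistribution zs → OnSupport (λ m → f m ≡ q) zs → mean f zs ≡ q
  OnSupport≡⇒mean≡ {f} {q} {zs} d f≡q =
    trans (sum-cong zs (All.zipWith (λ (0≤μ , f≡q) → termwise 0≤μ f≡q) (nonNeg d , f≡q))) (mean-const q d)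
    where
    termwise : ∀ {μ m} → 0ℚ ≤ μ → (0ℚ < μ → f m ≡ q) → μ * f m ≡ μ * q
    termwise {μ} {m} 0≤μ f≡q with 0≤p⇒p≡0⊎0<p 0≤μ
    ... | inj₁ refl = trans (*-zeroˡ (f m)) (sym (*-zeroˡ q))
    ... | inj₂ 0<μ  = cong (μ *_) (f≡q 0<μ)

  support-nonEmpty : ∀ {zs} → IsDistribution zs → Any (λ z → 0ℚ < proj₁ z) zs
  support-nonEmpty {[]}           d = contradiction (sym (total d)) 1≢0
  support-nonEmpty {(μ , m) ∷ zs} record { nonNeg = 0≤μ ∷ 0≤μs ; total = Σ≡1 } with 0≤p⇒p≡0⊎0<p 0≤μ
  ... | inj₂ 0<μ  = here 0<μ
  ... | inj₁ refl = there (support-nonEmpty record { nonNeg = 0≤μs ; total = trans (sym (+-identityˡ _)) Σ≡1 })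

  OnSupport-∀ : ∀ {J : Set} {P : J → A → Set} zs → (∀ j → OnSupport (P j) zs) → OnSupport (λ m → ∀ j → P j m) zs
  OnSupport-∀ []       _   = []
  OnSupport-∀ (z ∷ zs) Pzs = (λ 0<μ j → All.head (Pzs j) 0<μ) ∷ OnSupport-∀ zs (λ j → All.tail (Pzs j))

  mean-indicator⇒OnSupport : ∀ (β : A → Bool) b {zs} → IsDistribution zs →
                             mean (λ m → indicator (β m)) zs ≡ indicator b → OnSupport (λ m → β m ≡ b) zs
  mean-indicator⇒OnSupport β b {zs} d mean≡b =
    All.map (λ ind≡ 0<μ → indicator-injective (ind≡ 0<μ)) (pinned b mean≡b)
    where
    pinned : ∀ b → mean (λ m → indicator (β m)) zs ≡ indicator b →
             OnSupport (λ m → indicator (β m) ≡ indicator b) zs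
    pinned true  = mean≡max⇒OnSupport≡max d (All.universal (λ z → indicator≤1 (β (proj₂ z))) zs)
    pinned false = mean≡0⇒OnSupport≡0 (nonNeg d) (All.universal (λ z → 0≤indicator (β (proj₂ z))) zs)

  mean-indicators⇒OnSupport : ∀ {J : Set} (β : J → A → Bool) (b : J → Bool) {zs} → IsDistribution zs →
                              (∀ j → mean (λ m → indicator (β j m)) zs ≡ indicator (b j)) →
                              OnSupport (λ m → ∀ j → β j m ≡ b j) zs
  mean-indicators⇒OnSupport β b {zs} d means =
    OnSupport-∀ zs (λ j → mean-indicator⇒OnSupport (β j) (b j) d (means j))

  mix : ℚ → A → A → List (ℚ × A)
  mix t a b = (t , a) ∷ (1ℚ - t , b) ∷ []

  mean-mix : ∀ (f : A → ℚ) t a b → mean f (mix t a b) ≡ t * f a + (1ℚ - t) * f b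
  mean-mix f t a b = cong (t * f a +_) (+-identityʳ _)

  mix-isDistribution : ∀ {t} {a b : A} → 0ℚ < t → t < 1ℚ → IsDistribution (mix t a b)
  mix-isDistribution {t} 0<t t<1 = record
    { nonNeg = <⇒≤ 0<t ∷ <⇒≤ (p<q⇒0<q-p t<1) ∷ []
    ; total  = solve 1 (λ t → t :+ ((con 1ℚ :- t) :+ con 0ℚ) := con 1ℚ) refl t
    }

  mix-onSupport : ∀ {t} {a b : A} {P : A → Set} → 0ℚ < t → t < 1ℚ → OnSupport P (mix t a b) → P a × P b
  mix-onSupport 0<t t<1 (Pa ∷ Pb ∷ []) = Pa 0<t , Pb (p<q⇒0<q-p t<1)

mix≡max⇒≡max : ∀ {t a b c} → 0ℚ < t → t < 1ℚ → a ≤ c → b ≤ c →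
               t * a + (1ℚ - t) * b ≡ c → a ≡ c × b ≡ c
mix≡max⇒≡max {t} {a} {b} 0<t t<1 a≤c b≤c ≡c = mix-onSupport 0<t t<1
  (mean≡max⇒OnSupport≡max {f = id} (mix-isDistribution 0<t t<1) (a≤c ∷ b≤c ∷ []) (trans (mean-mix id t a b) ≡c))

mix≡indicator⇒≡indicator : ∀ {t a b} β → 0ℚ < t → t < 1ℚ → 0ℚ ≤ a → a ≤ 1ℚ → 0ℚ ≤ b → b ≤ 1ℚ →
                           t * a + (1ℚ - t) * b ≡ indicator β → a ≡ indicator β × b ≡ indicator β
mix≡indicator⇒≡indicator true 0<t t<1 _ a≤1 _ b≤1 ≡1 = mix≡max⇒≡max 0<t t<1 a≤1 b≤1 ≡1
mix≡indicator⇒≡indicator {t} {a} {b} false 0<t t<1 0≤a _ 0≤b _ ≡0 = mix-onSupport 0<t t<1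
  (mean≡0⇒OnSupport≡0 {f = id} (IsDistribution.nonNeg (mix-isDistribution 0<t t<1)) (0≤a ∷ 0≤b ∷ [])
    (trans (mean-mix id t a b) ≡0))

-- Convex hulls of finite lists of points

map-proj₁-zip : ∀ {A B : Set} (xs : List A) (ys : List B) → length xs ≡ length ys → map proj₁ (zip xs ys) ≡ xs
map-proj₁-zip []       []       _   = refl
map-proj₁-zip (x ∷ xs) (y ∷ ys) len = cong (x ∷_) (map-proj₁-zip xs ys (suc-injective len))

zip-∈ʳ : ∀ {A B : Set} (xs : List A) (ys : List B) → All (λ z → proj₂ z ∈ ys) (zip xs ys)
zip-∈ʳ []       ys       = []
zip-∈ʳ (x ∷ xs) []       = []
zip-∈ʳ (x ∷ xs) (y ∷ ys) = here refl ∷ All.map there (zip-∈ʳ xs ys)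

barycentre : ∀ {A I : Set} → (A → I → ℚ) → List (ℚ × A) → I → ℚ
barycentre f zs i = mean (λ m → f m i) zs

combination : ∀ {I : Set} → List ℚ → List (I → ℚ) → I → ℚ
combination ws ps i = sumℚ (zipWith (λ w p → w * p i) ws ps)

module _ {I : Set} (cs : List I) where

  ≈-sym : ∀ {x y : I → ℚ} → x ≈[ cs ] y → y ≈[ cs ] x
  ≈-sym = All.map sym

  ≈-trans : ∀ {x y z : I → ℚ} → x ≈[ cs ] y → y ≈[ cs ] z → x ≈[ cs ] z
  ≈-trans x≈y y≈z = All.zipWith (λ (x≡y , y≡z) → trans x≡y y≡z) (x≈y , y≈z)

  dot-cong : ∀ w {x y} → x ≈[ cs ] y → dot cs w x ≡ dot cs w y
  dot-cong w x≈y = sum-cong cs (All.map (cong (w _ *_)) x≈y)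

  dot-barycentre : ∀ {A : Set} w (f : A → I → ℚ) zs →
                   dot cs w (barycentre f zs) ≡ mean (λ m → dot cs w (f m)) zs
  dot-barycentre w f zs = begin
    sumℚ (map (λ i → w i * sumℚ (map (λ z → proj₁ z * f (proj₂ z) i) zs)) cs)
      ≡⟨ sum-cong-≗ cs (λ i → sum-*ˡ (w i) _ zs) ⟨
    sumℚ (map (λ i → sumℚ (map (λ z → w i * (proj₁ z * f (proj₂ z) i)) zs)) cs)
      ≡⟨ sum-comm (λ i z → w i * (proj₁ z * f (proj₂ z) i)) cs zs ⟩
    sumℚ (map (λ z → sumℚ (map (λ i → w i * (proj₁ z * f (proj₂ z) i)) cs)) zs)
      ≡⟨ sum-cong-≗ zs (λ z → sum-cong-≗ cs (λ i → regroup (w i) (proj₁ z) (f (proj₂ z) i))) ⟩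
    sumℚ (map (λ z → sumℚ (map (λ i → proj₁ z * (w i * f (proj₂ z) i)) cs)) zs)
      ≡⟨ sum-cong-≗ zs (λ z → sum-*ˡ (proj₁ z) _ cs) ⟩
    mean (λ m → dot cs w (f m)) zs ∎
    where
    open ≡-Reasoning
    regroup : ∀ a μ b → a * (μ * b) ≡ μ * (a * b)
    regroup = solve 3 (λ a μ b → a :* (μ :* b) := μ :* (a :* b)) refl

  dot-mix : ∀ w y z t → dot cs w (λ i → t * y i + (1ℚ - t) * z i) ≡ t * dot cs w y + (1ℚ - t) * dot cs w z
  dot-mix w y z t = begin
    dot cs w (λ i → t * y i + (1ℚ - t) * z i)
      ≡⟨ dot-cong w (All.universal (λ i → sym (mean-mix (λ p → p i) t y z)) cs) ⟩
    dot cs w (barycentre id (mix t y z))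
      ≡⟨ dot-barycentre w id (mix t y z) ⟩
    mean (dot cs w) (mix t y z)
      ≡⟨ mean-mix (dot cs w) t y z ⟩
    t * dot cs w y + (1ℚ - t) * dot cs w z ∎
    where open ≡-Reasoning

  combination-zeroWeights : ∀ {ws} (qs : List (I → ℚ)) → All (_≡ 0ℚ) ws → ∀ i → combination ws qs i ≡ 0ℚ
  combination-zeroWeights {[]}    qs       _             i = refl
  combination-zeroWeights {_ ∷ _} []       _             i = refl
  combination-zeroWeights         (q ∷ qs) (refl ∷ ws≡0) i =
    trans (cong₂ _+_ (*-zeroˡ (q i)) (combination-zeroWeights qs ws≡0 i)) (+-identityʳ 0ℚ)

  combination-scale : ∀ k ws (qs : List (I → ℚ)) i → combination (map (k *_) ws) qs i ≡ k * combination ws qs i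
  combination-scale k []       qs       i = sym (*-zeroʳ k)
  combination-scale k (w ∷ ws) []       i = sym (*-zeroʳ k)
  combination-scale k (w ∷ ws) (q ∷ qs) i =
    trans (cong₂ _+_ (*-assoc k w (q i)) (combination-scale k ws qs i)) (sym (*-distribˡ-+ k _ _))

  InConv-resp-≈ : ∀ {ps x y} → InConv cs ps x → x ≈[ cs ] y → InConv cs ps y
  InConv-resp-≈ (ws , len , 0≤ws , Σ≡1 , comb≈x) x≈y = ws , len , 0≤ws , Σ≡1 , ≈-trans comb≈x x≈y

  InConv-here : ∀ q qs → InConv cs (q ∷ qs) q
  InConv-here q qs =
    1ℚ ∷ zeros , cong suc (length-map _ qs) , 0≤1 ∷ All.map⁺ (All.universal (λ _ → ≤-refl) qs) ,
    trans (cong (1ℚ +_) (sum-0 qs)) (+-identityʳ 1ℚ) , All.universal onlyHead cs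
    where
    zeros : List ℚ
    zeros = map (λ _ → 0ℚ) qs
    onlyHead : ∀ i → 1ℚ * q i + combination zeros qs i ≡ q i
    onlyHead i = trans (cong₂ _+_ (*-identityˡ (q i)) (combination-zeroWeights qs zeros≡0 i)) (+-identityʳ (q i))
      where
      zeros≡0 : All (_≡ 0ℚ) zeros
      zeros≡0 = All.map⁺ (All.universal (λ _ → refl) qs)

  InConv-there : ∀ {q qs x} → InConv cs qs x → InConv cs (q ∷ qs) x
  InConv-there {q} {qs} (ws , len , 0≤ws , Σ≡1 , comb≈x) =
    0ℚ ∷ ws , cong suc len , ≤-refl ∷ 0≤ws , trans (+-identityˡ _) Σ≡1 ,
    All.map (λ {i} comb≡x → trans (dropHead i) comb≡x) comb≈x
    where
    dropHead : ∀ i → 0ℚ * q i + combination ws qs i ≡ combination ws qs i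
    dropHead i = trans (cong (_+ combination ws qs i) (*-zeroˡ (q i))) (+-identityˡ _)

  ∈⇒InConv : ∀ {p ps} → p ∈ ps → InConv cs ps p
  ∈⇒InConv {ps = p ∷ qs} (here refl) = InConv-here p qs
  ∈⇒InConv (there p∈ps)              = InConv-there (∈⇒InConv p∈ps)

  InConv⇒barycentre : ∀ {A : Set} (f : A → I → ℚ) ms {x} → InConv cs (map f ms) x →
                      ∃ λ zs → IsDistribution zs × All (λ z → proj₂ z ∈ ms) zs × x ≈[ cs ] barycentre f zs
  InConv⇒barycentre f ms (ws , len , 0≤ws , Σ≡1 , comb≈x) =
    zip ws ms ,
    record { nonNeg = All.map⁻ (subst (All (0ℚ ≤_)) (sym weights≡ws) 0≤ws)
           ; total  = trans (cong sumℚ weights≡ws) Σ≡1 } ,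
    zip-∈ʳ ws ms ,
    All.map (λ {i} comb≡x → trans (sym comb≡x) (cong sumℚ (terms≡ i))) comb≈x
    where
    open ≡-Reasoning
    weights≡ws : map proj₁ (zip ws ms) ≡ ws
    weights≡ws = map-proj₁-zip ws ms (trans len (length-map f ms))
    terms≡ : ∀ i → zipWith (λ w p → w * p i) ws (map f ms) ≡ map (λ z → proj₁ z * f (proj₂ z) i) (zip ws ms)
    terms≡ i = begin
      zipWith (λ w p → w * p i) ws (map f ms)
        ≡⟨ cong (λ vs → zipWith (λ w p → w * p i) vs (map f ms)) (map-id ws) ⟨
      zipWith (λ w p → w * p i) (map id ws) (map f ms)
        ≡⟨ zipWith-map (λ w p → w * p i) id f ws ms ⟩
      zipWith (λ w m → w * f m i) ws ms
        ≡⟨ map-zipWith _,_ (λ z → proj₁ z * f (proj₂ z) i) ws ms ⟨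
      map (λ z → proj₁ z * f (proj₂ z) i) (zip ws ms) ∎

  dot-≤-on-hull : ∀ {A : Set} (f : A → I → ℚ) ms w c →
                  All (λ m → dot cs w (f m) ≤ c) ms → Valid cs (map f ms) w c
  dot-≤-on-hull f ms w c f≤c x x∈hull with InConv⇒barycentre f ms x∈hull
  ... | zs , d , zs⊆ms , x≈ = subst (_≤ c) (sym (trans (dot-cong w x≈) (dot-barycentre w f zs)))
                                 (mean-≤ d (All.map (All.lookup f≤c) zs⊆ms))

  dot-≥-on-hull : ∀ {A : Set} (f : A → I → ℚ) ms w c →
                  All (λ m → c ≤ dot cs w (f m)) ms → ∀ x → InConv cs (map f ms) x → c ≤ dot cs w x
  dot-≥-on-hull f ms w c c≤f x x∈hull with InConv⇒barycentre f ms x∈hull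
  ... | zs , d , zs⊆ms , x≈ = subst (c ≤_) (sym (trans (dot-cong w x≈) (dot-barycentre w f zs)))
                                 (mean-≥ d (All.map (All.lookup c≤f) zs⊆ms))

  combination-normalise : ∀ {ws} qs → length ws ≡ length qs → All (0ℚ ≤_) ws → 0ℚ < sumℚ ws →
                          ∃ λ x′ → InConv cs qs x′ × ∀ i → combination ws qs i ≡ sumℚ ws * x′ i
  combination-normalise {ws} qs len 0≤ws 0<s =
    combination rescaled qs ,
    (rescaled , trans (length-map _ ws) len , All.map⁺ (All.map (0≤p∧0≤q⇒0≤p*q 0≤1/s) 0≤ws) ,
     rescaled-sum , All.universal (λ _ → refl) cs) ,
    rescale
    where
    open ≡-Reasoning
    s : ℚ
    s = sumℚ ws
    instance
      s≢0 : NonZero s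
      s≢0 = pos⇒nonZero s {{positive 0<s}}
    0≤1/s : 0ℚ ≤ 1/ s
    0≤1/s = <⇒≤ (positive⁻¹ (1/ s) {{1/pos⇒pos s {{positive 0<s}}}})
    rescaled : List ℚ
    rescaled = map (1/ s *_) ws
    rescaled-sum : sumℚ rescaled ≡ 1ℚ
    rescaled-sum = trans (sum-*ˡ (1/ s) id ws) (trans (cong (λ vs → 1/ s * sumℚ vs) (map-id ws)) (*-inverseˡ s))
    rescale : ∀ i → combination ws qs i ≡ s * combination rescaled qs i
    rescale i = begin
      combination ws qs i               ≡⟨ *-identityˡ _ ⟨
      1ℚ * combination ws qs i          ≡⟨ cong (_* combination ws qs i) (*-inverseʳ s) ⟨
      (s * 1/ s) * combination ws qs i  ≡⟨ *-assoc s (1/ s) _ ⟩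
      s * (1/ s * combination ws qs i)  ≡⟨ cong (s *_) (combination-scale (1/ s) ws qs i) ⟨
      s * combination rescaled qs i     ∎

  data HeadSplit (q : I → ℚ) (qs : List (I → ℚ)) (x : I → ℚ) : Set where
    tail-only  : InConv cs qs x → HeadSplit q qs x
    head-only  : x ≈[ cs ] q → HeadSplit q qs x
    strict-mix : ∀ {t x′} → 0ℚ < t → t < 1ℚ → InConv cs qs x′ →
                 x ≈[ cs ] (λ i → t * q i + (1ℚ - t) * x′ i) → HeadSplit q qs x

  InConv-∷⇒HeadSplit : ∀ {q qs x} → InConv cs (q ∷ qs) x → HeadSplit q qs x
  InConv-∷⇒HeadSplit {q} {qs} (μ ∷ ws , len , 0≤μ ∷ 0≤ws , μ+s≡1 , comb≈x) with 0≤p⇒p≡0⊎0<p (sum-nonNeg 0≤ws)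
  ... | inj₁ s≡0 = head-only (All.map (λ {i} comb≡x → trans (sym comb≡x) (onlyHead i)) comb≈x)
    where
    μ≡1 : μ ≡ 1ℚ
    μ≡1 = trans (sym (+-identityʳ μ)) (trans (cong (μ +_) (sym s≡0)) μ+s≡1)
    onlyHead : ∀ i → μ * q i + combination ws qs i ≡ q i
    onlyHead i = begin
      μ * q i + combination ws qs i
        ≡⟨ cong₂ _+_ (cong (_* q i) μ≡1) (combination-zeroWeights qs (sum-nonNeg-≡0 0≤ws s≡0) i) ⟩
      1ℚ * q i + 0ℚ
        ≡⟨ trans (+-identityʳ _) (*-identityˡ (q i)) ⟩
      q i ∎
      where open ≡-Reasoning
  ... | inj₂ 0<s with 0≤p⇒p≡0⊎0<p 0≤μ
  ...   | inj₁ refl = tail-only (ws , suc-injective len , 0≤ws , trans (sym (+-identityˡ _)) μ+s≡1 ,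
                                 All.map (λ {i} comb≡x → trans (sym (dropHead i)) comb≡x) comb≈x)
    where
    dropHead : ∀ i → 0ℚ * q i + combination ws qs i ≡ combination ws qs i
    dropHead i = trans (cong (_+ combination ws qs i) (*-zeroˡ (q i))) (+-identityˡ _)
  ...   | inj₂ 0<μ  =
    let x′ , x′∈qs , comb≡ = combination-normalise qs (suc-injective len) 0≤ws 0<s
    in strict-mix 0<μ μ<1 x′∈qs (All.map (λ {i} comb≡x → trans (sym comb≡x) (cong (μ * q i +_) (split (comb≡ i))))
                                         comb≈x)
    where
    μ<1 : μ < 1ℚ
    μ<1 = subst₂ _<_ (+-identityʳ μ) μ+s≡1 (+-monoʳ-< μ 0<s)
    s≡1-μ : sumℚ ws ≡ 1ℚ - μ
    s≡1-μ = trans (solve 2 (λ μ s → s := (μ :+ s) :- μ) refl μ (sumℚ ws)) (cong (_- μ) μ+s≡1)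
    split : ∀ {u v} → u ≡ sumℚ ws * v → u ≡ (1ℚ - μ) * v
    split {v = v} u≡sv = trans u≡sv (cong (_* v) s≡1-μ)

  module _ {ps : List (I → ℚ)} {w c} (valid : Valid cs ps w c) where

    vertexOfFace⇒generator : ∀ {x} → IsVertexOfFace cs ps w c x → Any (x ≈[ cs ]_) ps
    vertexOfFace⇒generator {x} ((x∈ps , wx≡c) , extreme) = search id x∈ps
      where
      search : ∀ {qs} → (∀ {y} → InConv cs qs y → InConv cs ps y) → InConv cs qs x → Any (x ≈[ cs ]_) qs
      search {[]}     _     ([] , _ , _ , 0≡1 , _) = contradiction (sym 0≡1) 1≢0
      search {q ∷ qs} qs⊆ps x∈qqs with InConv-∷⇒HeadSplit x∈qqs
      ... | tail-only x∈qs = there (search (qs⊆ps ∘ InConv-there) x∈qs)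
      ... | head-only x≈q  = here x≈q
      ... | strict-mix {t} {x′} 0<t t<1 x′∈qs x≈mix = here (≈-trans x≈mix (All.map collapse q≈x′))
        where
        q∈ps : InConv cs ps q
        q∈ps = qs⊆ps (InConv-here q qs)
        x′∈ps : InConv cs ps x′
        x′∈ps = qs⊆ps (InConv-there x′∈qs)
        onFace : dot cs w q ≡ c × dot cs w x′ ≡ c
        onFace = mix≡max⇒≡max 0<t t<1 (valid q q∈ps) (valid x′ x′∈ps)
                   (trans (sym (dot-mix w q x′ t)) (trans (sym (dot-cong w x≈mix)) wx≡c))
        q≈x′ : q ≈[ cs ] x′
        q≈x′ = extreme q x′ t (q∈ps , proj₁ onFace) (x′∈ps , proj₂ onFace) 0<t t<1 x≈mix
        collapse : ∀ {i} → q i ≡ x′ i → t * q i + (1ℚ - t) * x′ i ≡ q i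
        collapse {i} q≡x′ = trans (cong (λ v → t * q i + (1ℚ - t) * v) (sym q≡x′))
                                  (solve 2 (λ t v → t :* v :+ (con 1ℚ :- t) :* v := v) refl t (q i))

-- Base polytopes and matroids

∈allSubs : ∀ {n} (B : Sub n) → B ∈ allSubs n
∈allSubs []ᵛ          = here refl
∈allSubs (false ∷ᵛ B) = ∈-++⁺ˡ (∈-map⁺ (false ∷ᵛ_) (∈allSubs B))
∈allSubs (true  ∷ᵛ B) = ∈-++⁺ʳ (map (false ∷ᵛ_) (allSubs _)) (∈-map⁺ (true ∷ᵛ_) (∈allSubs B))

lookup-injective : ∀ {n} {u v : Sub n} → (∀ i → lookup u i ≡ lookup v i) → u ≡ v
lookup-injective {u = u} {v} u≗v =
  trans (sym (tabulate∘lookup u)) (trans (tabulate-cong u≗v) (tabulate∘lookup v))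

indVec-InConv⇒∈ : ∀ {n} {Bs : List (Sub n)} {B} → InConv (allFin n) (map indVec Bs) (indVec B) → B ∈ Bs
indVec-InConv⇒∈ {n} {Bs} {B} B∈hull with InConv⇒barycentre (allFin n) indVec Bs B∈hull
... | zs , d , zs⊆Bs , B≈ =
  let (B′≗B , B′∈Bs) , 0<μ = All.lookupAny (All.zipWith id (agree , zs⊆Bs)) (support-nonEmpty d)
  in subst (_∈ Bs) (lookup-injective (B′≗B 0<μ)) B′∈Bs
  where
  agree : OnSupport (λ B′ → ∀ i → lookup B′ i ≡ lookup B i) zs
  agree = mean-indicators⇒OnSupport (λ i B′ → lookup B′ i) (lookup B) d (λ i → sym (All.lookup B≈ (∈-allFin i)))

indicatorℤ : Bool → ℤ
indicatorℤ b = if b then ℤ.+ 1 else ℤ.+ 0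

isIndicatorValue-indVec : ∀ {n} (S : Fam n) B → IsIndicatorValue (InBasePolytope S (indVec B)) (indicatorℤ (S B))
isIndicatorValue-indVec {n} S B with S B in SB≡b
... | true  = inj₁ (refl , ∈⇒InConv (allFin n) (∈-map⁺ indVec B∈bases))
  where
  B∈bases : B ∈ bases S
  B∈bases = ∈-filter⁺ (T? ∘ S) (∈allSubs B) (subst T (sym SB≡b) tt)
... | false = inj₂ (refl , λ B∈P → subst T SB≡b (proj₂ (∈-filter⁻ (T? ∘ S) {xs = allSubs n} (indVec-InConv⇒∈ B∈P))))

-- A family is a function, so matroids with the same bases need not be equal; the members
-- of allFams are fixed points of this normal form, which makes them extensional.
canonical : ∀ n → Fam n → Fam n
canonical zero    f = if f []ᵛ then (λ _ → true) else (λ _ → false)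
canonical (suc n) f = joinFam (canonical n (f ∘ (false ∷ᵛ_))) (canonical n (f ∘ (true ∷ᵛ_)))

canonical-cong : ∀ n {f g : Fam n} → (∀ B → f B ≡ g B) → canonical n f ≡ canonical n g
canonical-cong zero    f≗g = cong (λ b → if b then (λ _ → true) else (λ _ → false)) (f≗g []ᵛ)
canonical-cong (suc n) f≗g =
  cong₂ joinFam (canonical-cong n (f≗g ∘ (false ∷ᵛ_))) (canonical-cong n (f≗g ∘ (true ∷ᵛ_)))

allFams-canonical : ∀ n → All (λ f → f ≡ canonical n f) (allFams n)
allFams-canonical zero    = refl ∷ refl ∷ []
allFams-canonical (suc n) = All.concat⁺ (All.map⁺ (All.map (λ f≡ → All.map⁺ (All.map (cong₂ joinFam f≡) ih)) ih))
  where
  ih : All (λ f → f ≡ canonical n f) (allFams n)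
  ih = allFams-canonical n

allFams-ext : ∀ {n} {f g : Fam n} → f ∈ allFams n → g ∈ allFams n → (∀ B → f B ≡ g B) → f ≡ g
allFams-ext {n} f∈ g∈ f≗g = trans (All.lookup (allFams-canonical n) f∈)
                                  (trans (canonical-cong n f≗g) (sym (All.lookup (allFams-canonical n) g∈)))

matroid-ext : ∀ {r n} {M M′ : Fam n} → M ∈ matroids r n → M′ ∈ matroids r n → (∀ B → M B ≡ M′ B) → M ≡ M′
matroid-ext {r} {n} M∈ M′∈ = allFams-ext (proj₁ (∈-filter⁻ (T? ∘ isMatroid r) {xs = allFams n} M∈))
                                         (proj₁ (∈-filter⁻ (T? ∘ isMatroid r) {xs = allFams n} M′∈))

-- Schubert coordinates

toℚ-+ : ∀ x y → toℚ (x ℤ.+ y) ≡ toℚ x + toℚ y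
toℚ-+ x y = toℚᵘ-injective (begin
  toℚᵘ (toℚ (x ℤ.+ y))
    ≈⟨ toℚᵘ-fromℚᵘ (ℚᵘ.mkℚᵘ (x ℤ.+ y) 0) ⟩
  ℚᵘ.mkℚᵘ (x ℤ.+ y) 0
    ≈⟨ ℚᵘ.*≡* (cong (ℤ._* ℤ.+ 1) (cong₂ ℤ._+_ (ℤ.*-identityʳ x) (ℤ.*-identityʳ y))) ⟨
  ℚᵘ.mkℚᵘ x 0 ℚᵘ.+ ℚᵘ.mkℚᵘ y 0
    ≈⟨ ℚᵘ.+-cong (toℚᵘ-fromℚᵘ (ℚᵘ.mkℚᵘ x 0)) (toℚᵘ-fromℚᵘ (ℚᵘ.mkℚᵘ y 0)) ⟨
  toℚᵘ (toℚ x) ℚᵘ.+ toℚᵘ (toℚ y)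
    ≈⟨ toℚᵘ-homo-+ (toℚ x) (toℚ y) ⟨
  toℚᵘ (toℚ x + toℚ y) ∎)
  where open ℚᵘ.≃-Reasoning

toℚ-* : ∀ x y → toℚ (x ℤ.* y) ≡ toℚ x * toℚ y
toℚ-* x y = toℚᵘ-injective (begin
  toℚᵘ (toℚ (x ℤ.* y))
    ≈⟨ toℚᵘ-fromℚᵘ (ℚᵘ.mkℚᵘ (x ℤ.* y) 0) ⟩
  ℚᵘ.mkℚᵘ x 0 ℚᵘ.* ℚᵘ.mkℚᵘ y 0
    ≈⟨ ℚᵘ.*-cong (toℚᵘ-fromℚᵘ (ℚᵘ.mkℚᵘ x 0)) (toℚᵘ-fromℚᵘ (ℚᵘ.mkℚᵘ y 0)) ⟨
  toℚᵘ (toℚ x) ℚᵘ.* toℚᵘ (toℚ y)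
    ≈⟨ toℚᵘ-homo-* (toℚ x) (toℚ y) ⟨
  toℚᵘ (toℚ x * toℚ y) ∎)
  where open ℚᵘ.≃-Reasoning

toℚ-sumℤ : ∀ {A : Set} (h : A → ℤ) xs → toℚ (sumℤ (map h xs)) ≡ sumℚ (map (toℚ ∘ h) xs)
toℚ-sumℤ h []       = refl
toℚ-sumℤ h (x ∷ xs) = trans (toℚ-+ (h x) _) (cong (toℚ (h x) +_) (toℚ-sumℤ h xs))

toℚ-indicatorℤ : ∀ b → toℚ (indicatorℤ b) ≡ indicator b
toℚ-indicatorℤ true  = refl
toℚ-indicatorℤ false = refl

atVertex : ∀ {n} → Sub n → Fam n → ℚ
atVertex B S = indicator (S B)

module _ {r n : ℕ} {a : Fam n → Fam n → ℤ} (expansion : IsSchubertExpansion r n a) where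

  private
    cs : List (Fam n)
    cs = schuberts r n
    ms : List (Fam n)
    ms = matroids r n

  dot-atVertex-pbar : ∀ {M} → M ∈ ms → ∀ B → dot cs (atVertex B) (pbar a M) ≡ indicator (M B)
  dot-atVertex-pbar {M} M∈ B = begin
    sumℚ (map (λ S → indicator (S B) * toℚ (a M S)) cs)
      ≡⟨ sum-cong-≗ cs (λ S → trans (*-comm (indicator (S B)) (toℚ (a M S))) (sym (toℚ-term S))) ⟩
    sumℚ (map (λ S → toℚ (a M S ℤ.* indicatorℤ (S B))) cs)
      ≡⟨ toℚ-sumℤ (λ S → a M S ℤ.* indicatorℤ (S B)) cs ⟨
    toℚ (sumℤ (map (λ S → a M S ℤ.* indicatorℤ (S B)) cs))
      ≡⟨ cong toℚ expanded ⟨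
    toℚ (indicatorℤ (M B))
      ≡⟨ toℚ-indicatorℤ (M B) ⟩
    indicator (M B) ∎
    where
    open ≡-Reasoning
    expanded : indicatorℤ (M B) ≡ sumℤ (map (λ S → a M S ℤ.* indicatorℤ (S B)) cs)
    expanded = All.lookup expansion M∈ (indVec B) (λ S → indicatorℤ (S B))
                 (isIndicatorValue-indVec M B) (All.universal (λ S → isIndicatorValue-indVec S B) cs)
    toℚ-term : ∀ S → toℚ (a M S ℤ.* indicatorℤ (S B)) ≡ toℚ (a M S) * indicator (S B)
    toℚ-term S = trans (toℚ-* (a M S) _) (cong (toℚ (a M S) *_) (toℚ-indicatorℤ (S B)))

  pbar-pinned : ∀ {M y} → M ∈ ms → InConv cs (map (pbar a) ms) y →
                (∀ B → dot cs (atVertex B) y ≡ indicator (M B)) → y ≈[ cs ] pbar a M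
  pbar-pinned {M} {y} M∈ y∈hull y-at-vertices with InConv⇒barycentre cs (pbar a) ms y∈hull
  ... | zs , d , zs⊆ms , y≈ = ≈-trans cs y≈ (All.universal (λ S → OnSupport≡⇒mean≡ d (coordinate S)) cs)
    where
    open ≡-Reasoning
    means : ∀ B → mean (λ m → indicator (m B)) zs ≡ indicator (M B)
    means B = begin
      mean (λ m → indicator (m B)) zs
        ≡⟨ sum-cong zs (All.map (λ {z} m∈ → cong (proj₁ z *_) (sym (dot-atVertex-pbar m∈ B))) zs⊆ms) ⟩
      mean (λ m → dot cs (atVertex B) (pbar a m)) zs
        ≡⟨ dot-barycentre cs (atVertex B) (pbar a) zs ⟨
      dot cs (atVertex B) (barycentre (pbar a) zs)
        ≡⟨ dot-cong cs (atVertex B) y≈ ⟨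
      dot cs (atVertex B) y
        ≡⟨ y-at-vertices B ⟩
      indicator (M B) ∎
    sameMatroid : OnSupport (_≡ M) zs
    sameMatroid = All.zipWith (λ (agree , m∈) 0<μ → matroid-ext m∈ M∈ (agree 0<μ))
                    (mean-indicators⇒OnSupport (λ B m → m B) M d means , zs⊆ms)
    coordinate : ∀ S → OnSupport (λ m → pbar a m S ≡ pbar a M S) zs
    coordinate S = All.map (λ m≡M 0<μ → cong (λ m → pbar a m S) (m≡M 0<μ)) sameMatroid

  pbar-extreme : ∀ {M y z t} → M ∈ ms → InConv cs (map (pbar a) ms) y → InConv cs (map (pbar a) ms) z →
                 0ℚ < t → t < 1ℚ → pbar a M ≈[ cs ] (λ S → t * y S + (1ℚ - t) * z S) → y ≈[ cs ] z
  pbar-extreme {M} {y} {z} {t} M∈ y∈hull z∈hull 0<t t<1 M≈mix =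
    ≈-trans cs (pbar-pinned M∈ y∈hull (proj₁ ∘ both)) (≈-sym cs (pbar-pinned M∈ z∈hull (proj₂ ∘ both)))
    where
    between : ∀ B x → InConv cs (map (pbar a) ms) x → 0ℚ ≤ dot cs (atVertex B) x × dot cs (atVertex B) x ≤ 1ℚ
    between B x x∈hull =
      dot-≥-on-hull cs (pbar a) ms (atVertex B) 0ℚ
        (All.tabulate (λ m∈ → subst (0ℚ ≤_) (sym (dot-atVertex-pbar m∈ B)) (0≤indicator _))) x x∈hull ,
      dot-≤-on-hull cs (pbar a) ms (atVertex B) 1ℚ
        (All.tabulate (λ m∈ → subst (_≤ 1ℚ) (sym (dot-atVertex-pbar m∈ B)) (indicator≤1 _))) x x∈hull
    both : ∀ B → dot cs (atVertex B) y ≡ indicator (M B) × dot cs (atVertex B) z ≡ indicator (M B)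
    both B =
      let 0≤y , y≤1 = between B y y∈hull
          0≤z , z≤1 = between B z z∈hull
      in mix≡indicator⇒≡indicator (M B) 0<t t<1 0≤y y≤1 0≤z z≤1
           (trans (sym (dot-mix cs (atVertex B) y z t)) (trans (sym (dot-cong cs (atVertex B) M≈mix))
                                                               (dot-atVertex-pbar M∈ B)))

-- Transferring the face

-- The paper's w̄_S = w_[S], summed over the class representatives isomorphic to S.
pullback : ∀ r n → (Fam n → ℚ) → Fam n → ℚ
pullback r n w S = sumℚ (map (λ c → if iso? S c then w c else 0ℚ) (schubertClasses r n))

dot-pullback : ∀ r n a w M →
               dot (schuberts r n) (pullback r n w) (pbar a M) ≡ dot (schubertClasses r n) w (pcls r n a M)
dot-pullback r n a w M =
  trans (sum-regroup iso? w (pbar a M) (schuberts r n) (schubertClasses r n))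
        (sum-cong-≗ (schubertClasses r n) (λ c → cong (w c *_) (sym (toℚ-sumℤ (a M) (classOf c)))))
  where
  classOf : Fam n → List (Fam n)
  classOf c = filterᵇ (λ S → iso? S c) (schuberts r n)

module FaceTransfer (r n : ℕ) (a : Fam n → Fam n → ℤ) (w : Fam n → ℚ) (c : ℚ)
                    (valid : Valid (schubertClasses r n) (map (pcls r n a) (matroids r n)) w c) where

  private
    cs : List (Fam n)
    cs = schuberts r n
    ms : List (Fam n)
    ms = matroids r n

  pcls∈hull : ∀ {M} → M ∈ ms → InConv (schubertClasses r n) (map (pcls r n a) ms) (pcls r n a M)
  pcls∈hull M∈ = ∈⇒InConv (schubertClasses r n) (∈-map⁺ (pcls r n a) M∈)

  pullback-valid : Valid cs (map (pbar a) ms) (pullback r n w) c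
  pullback-valid = dot-≤-on-hull cs (pbar a) ms (pullback r n w) c (All.tabulate (λ {M} M∈ →
    subst (_≤ c) (sym (dot-pullback r n a w M)) (valid (pcls r n a M) (pcls∈hull M∈))))

  pbar-vertexOfFace : IsSchubertExpansion r n a → ∀ {M x} → M ∈ ms →
                      dot (schubertClasses r n) w (pcls r n a M) ≡ c → x ≈[ cs ] pbar a M →
                      IsVertexOfFace cs (map (pbar a) ms) (pullback r n w) c x
  pbar-vertexOfFace expansion {M} M∈ onFace x≈M =
    (InConv-resp-≈ cs (∈⇒InConv cs (∈-map⁺ (pbar a) M∈)) (≈-sym cs x≈M) ,
     trans (dot-cong cs (pullback r n w) x≈M) (trans (dot-pullback r n a w M) onFace)) ,
    λ y z t (y∈ , _) (z∈ , _) 0<t t<1 x≈mix →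
      pbar-extreme {a = a} expansion M∈ y∈ z∈ 0<t t<1 (≈-trans cs (≈-sym cs x≈M) x≈mix)

  vertexOfFace⇒pcls-onFace : ∀ {x} → IsVertexOfFace cs (map (pbar a) ms) (pullback r n w) c x →
    Any (λ M → InFace (schubertClasses r n) (map (pcls r n a) ms) w c (pcls r n a M) × x ≈[ cs ] pbar a M) ms
  vertexOfFace⇒pcls-onFace vertex@((_ , wx≡c) , _) =
    let M , M∈ , x≈M = find (Any.map⁻ (vertexOfFace⇒generator cs {map (pbar a) ms} {pullback r n w} {c}
                                          pullback-valid vertex))
        pcls-onFace = trans (sym (dot-pullback r n a w M)) (trans (sym (dot-cong cs (pullback r n w) x≈M)) wx≡c)
    in lose M∈ ((pcls∈hull M∈ , pcls-onFace) , x≈M)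

lemma5p2 : (r n : ℕ) → r ℕ.≤ n → (a : Fam n → Fam n → ℤ) → IsSchubertExpansion r n a →
    (F : Fam n → Set) → IsoInvariant F →
    FacialCls r n a F → FacialBar r n a F
lemma5p2 r n _ a expansion F _ (w , c , valid , onFace⇔F) =
  pullback r n w , c , pullback-valid , λ x → isVertex x , fromVertex x
  where
  open FaceTransfer r n a w c valid
  isVertex : ∀ x → Any (λ M → F M × x ≈[ schuberts r n ] pbar a M) (matroids r n) →
             IsVertexOfFace (schuberts r n) (map (pbar a) (matroids r n)) (pullback r n w) c x
  isVertex x F∋x = let M , M∈ , FM , x≈M = find F∋x
                   in pbar-vertexOfFace expansion M∈ (proj₂ (proj₁ (All.lookup onFace⇔F M∈) FM)) x≈M
  fromVertex : ∀ x → IsVertexOfFace (schuberts r n) (map (pbar a) (matroids r n)) (pullback r n w) c x →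
               Any (λ M → F M × x ≈[ schuberts r n ] pbar a M) (matroids r n)
  fromVertex x vertex = let M , M∈ , onFace , x≈M = find (vertexOfFace⇒pcls-onFace vertex)
                        in lose M∈ (proj₂ (All.lookup onFace⇔F M∈) onFace , x≈M)
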